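{- Let $(\mathbb{D},G)$ be a data symmetry. (1) For any open subgroup $H\le G$, if $H$ has a least finite support then that least support is fungible. (2) If $(\mathbb{D},G)$ admits least supports, then every finite fungible $C\subseteq\mathbb{D}$ is the least support of $\mathrm{ext}_G(S)$, for every subgroup $S$ of the symmetric group $\mathrm{Sym}(C)$. (3) If $(\mathbb{D},G)$ is fungible, then every finite $C\subseteq\mathbb{D}$ is the least support of $\mathrm{ext}_G(S)$, for every subgroup $S\le\mathrm{Sym}(C)$.
   Context: A data symmetry is a set $\mathbb{D}$ with a subgroup $G$ of the group of all bijections of $\mathbb{D}$. For $C\subseteq\mathbb{D}$, $G_C=\{\pi\in G:\pi(c)=c\ \forall c\in C\}$. A finite $C$ supports a subgroup $H\le G$ if $G_C\le H$; $H$ is open if some finite $C$ supports it; a least support is a finite support contained in all finite supports. A finite $C\subseteq\mathbb{D}$ is fungible if for every $c\in C$ there is $\pi\in G$ with $\pi(c)\ne c$ and $\pi(c')=c'$ for all $c'\in C\setminus\{c\}$; $(\mathbb{D},G)$ is fungible if every finite subset of $\mathbb{D}$ is fungible. For $S\le\mathrm{Sym}(C)$, $\mathrm{ext}_G(S)=\{\pi\in G:\pi|_C\in S\}$ (here $\pi|_C\in S$ requires $\pi$ to map $C$ onto $C$). $(\mathbb{D},G)$ admits least supports if every element of every nominal $G$-set has a least finite support (equivalently: for any $H\le G$ and finite $C,D$, $G_C\le H$ and $G_D\le H$ imply $G_{C\cap D}\le H$). -}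

module Defs where

open import Data.List using (List; length; lookup)
open import Data.List.Membership.Propositional using (_∈_)
open import Data.Fin using (Fin)
open import Data.Product using (Σ; ∃; _×_)
open import Function.Bundles using (_↔_; Inverse)
open import Function.Construct.Identity using (↔-id)
open import Function.Construct.Composition using (_↔-∘_)
open import Function.Construct.Symmetry using (↔-sym)
open import Relation.Binary.PropositionalEquality using (_≡_; _≢_)

Sym : Set → Set
Sym X = X ↔ X

_⟨$⟩_ : {X : Set} → Sym X → X → X
π ⟨$⟩ x = Inverse.to π x

infix 9 _⟨$⟩_

-- A subgroup of Sym X, given as a predicate on bijections.  Bijections are
-- compared extensionally (pointwise), so membership must respect that.
record IsSubgroup {X : Set} (P : Sym X → Set) : Set where
  field
    resp  : ∀ {π ρ} → (∀ x → π ⟨$⟩ x ≡ ρ ⟨$⟩ x) → P π → P ρ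
    id∈   : P (↔-id X)
    ∘∈    : ∀ {π ρ} → P π → P ρ → P (π ↔-∘ ρ)
    inv∈  : ∀ {π} → P π → P (↔-sym π)

record DataSymmetry : Set₁ where
  field
    𝔻          : Set
    G          : Sym 𝔻 → Set
    G-subgroup : IsSubgroup G

module _ (DS : DataSymmetry) where
  open DataSymmetry DS

  _⊑_ : (Sym 𝔻 → Set) → (Sym 𝔻 → Set) → Set
  K ⊑ H = ∀ π → K π → H π

  IsSubgroupOfG : (Sym 𝔻 → Set) → Set
  IsSubgroupOfG H = (H ⊑ G) × IsSubgroup H

  Fix : (𝔻 → Set) → Sym 𝔻 → Set
  Fix P π = G π × (∀ c → P c → π ⟨$⟩ c ≡ c)

  -- Finite subsets of 𝔻 are represented by lists.
  -- G_C for finite C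
  Fixₗ : List 𝔻 → Sym 𝔻 → Set
  Fixₗ C = Fix (_∈ C)

  Supports : List 𝔻 → (Sym 𝔻 → Set) → Set
  Supports C H = Fixₗ C ⊑ H

  IsOpen : (Sym 𝔻 → Set) → Set
  IsOpen H = ∃ λ C → Supports C H

  IsLeastSupport : List 𝔻 → (Sym 𝔻 → Set) → Set
  IsLeastSupport C H = Supports C H × (∀ E → Supports E H → ∀ x → x ∈ C → x ∈ E)

  Fungible : List 𝔻 → Set
  Fungible C = ∀ c → c ∈ C →
    Σ (Sym 𝔻) λ π → G π × (π ⟨$⟩ c ≢ c)
      × (∀ c′ → c′ ∈ C → c′ ≢ c → π ⟨$⟩ c′ ≡ c′)

  FungibleDS : Set
  FungibleDS = ∀ C → Fungible C

  -- (𝔻, G) admits least supports (the equivalent characterisation from the paper)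
  AdmitsLeastSupports : Set₁
  AdmitsLeastSupports = ∀ (H : Sym 𝔻 → Set) → IsSubgroupOfG H → ∀ C E →
    Supports C H → Supports E H → Fix (λ x → (x ∈ C) × (x ∈ E)) ⊑ H

  -- ext_G(S) for a duplicate-free list C, where Sym(C) is identified with
  -- Sym (Fin (length C)) via  i ↦ lookup C i.  π|_C ∈ S means π maps C onto C
  -- inducing (via this identification) some σ ∈ S.
  ext : (C : List 𝔻) → (Sym (Fin (length C)) → Set) → Sym 𝔻 → Set
  ext C S π = G π × Σ (Sym (Fin (length C))) λ σ →
    S σ × (∀ i → π ⟨$⟩ lookup C i ≡ lookup C (σ ⟨$⟩ i))

-- (1) If no π ∈ G moves c while fixing the rest of C, then C ∖ {c} already
-- supports H (an element of G fixing C ∖ {c} must then fix c too), contradicting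
-- leastness.  (2, 3) An element of ext_G(S) maps C onto C, so if it fixes
-- C ∖ {c} it also fixes c.  Hence a support E of ext_G(S) missing some c ∈ C is
-- impossible: fungibility of C (resp. of E ∪ C) yields π ∈ G moving only c, and
-- π lies in ext_G(S) because it fixes C ∩ E, which supports ext_G(S) when least
-- supports are admitted (resp. because it fixes E).

module Submission where

open import Defs
open import Level using (0ℓ)
open import Axiom.ExcludedMiddle using (ExcludedMiddle)
open import Data.List using (List; length; lookup; filter; _++_)
open import Data.List.Relation.Unary.Unique.Propositional using (Unique)
open import Data.List.Relation.Unary.Any using (index)
open import Data.List.Relation.Unary.Any.Properties using (lookup-index)
open import Data.List.Membership.Propositional using (_∈_; _∉_)
open import Data.List.Membership.Propositional.Properties
  using (∈-lookup; ∈-filter⁺; ∈-filter⁻; ∈-++⁺ˡ; ∈-++⁺ʳ)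
open import Data.Fin using (Fin)
open import Data.Product using (Σ; _×_; _,_; proj₁; proj₂)
open import Data.Empty using (⊥-elim)
open import Relation.Nullary using (¬_; yes; no)
open import Relation.Binary.PropositionalEquality
  using (_≡_; _≢_; refl; sym; trans; cong; subst)
open import Function.Bundles using (Inverse; Injection)
open import Function.Properties.Inverse using (↔⇒↣)
open import Function.Construct.Identity using (↔-id)
open import Function.Construct.Composition using (_↔-∘_)
open import Function.Construct.Symmetry using (↔-sym)
open DataSymmetry

module _ (lem : ExcludedMiddle 0ℓ) (DS : DataSymmetry) where

  private
    D = 𝔻 DS
    module G = IsSubgroup (G-subgroup DS)

  MovesOnly : List D → D → Sym D → Set
  MovesOnly C c π = (π ⟨$⟩ c ≢ c) × (∀ c′ → c′ ∈ C → c′ ≢ c → π ⟨$⟩ c′ ≡ c′)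

  -- Fungible DS C unfolds to  ∀ c → c ∈ C → Mover C c.
  Mover : List D → D → Set
  Mover C c = Σ (Sym D) λ π → G DS π × MovesOnly C c π

  fixesAllBut⇒fixes : ∀ {C c} (π : Sym D) → π ⟨$⟩ c ∈ C →
    (∀ c′ → c′ ∈ C → c′ ≢ c → π ⟨$⟩ c′ ≡ c′) → π ⟨$⟩ c ≡ c
  fixesAllBut⇒fixes {c = c} π πc∈C fixesRest with lem {π ⟨$⟩ c ≡ c}
  ... | yes fixes = fixes
  ... | no moves = ⊥-elim (moves (Injection.injective (↔⇒↣ π)
                     (fixesRest (π ⟨$⟩ c) πc∈C moves)))

  _∖_ : List D → D → List D
  C ∖ c = filter (λ y → lem {y ≢ c}) C

  ∈-∖⁺ : ∀ {C c x} → x ∈ C → x ≢ c → x ∈ C ∖ c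
  ∈-∖⁺ {c = c} = ∈-filter⁺ (λ y → lem {y ≢ c})

  ∈-∖⁻ : ∀ {C c x} → x ∈ C ∖ c → x ≢ c
  ∈-∖⁻ {C} {c} x∈C∖c = proj₂ (∈-filter⁻ (λ y → lem {y ≢ c}) {xs = C} x∈C∖c)

  supports-∖ : ∀ {C c} {H : Sym D → Set} → Supports DS C H → ¬ Mover C c →
    Supports DS (C ∖ c) H
  supports-∖ {C} {c} supC noMover π (g , fixesC∖c) with lem {π ⟨$⟩ c ≡ c}
  ... | no moves = ⊥-elim (noMover (π , g , moves , fixesRest))
    where
    fixesRest : ∀ c′ → c′ ∈ C → c′ ≢ c → π ⟨$⟩ c′ ≡ c′
    fixesRest c′ c′∈C c′≢c = fixesC∖c c′ (∈-∖⁺ c′∈C c′≢c)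
  ... | yes fixes = supC π (g , fixesC)
    where
    fixesC : ∀ c′ → c′ ∈ C → π ⟨$⟩ c′ ≡ c′
    fixesC c′ c′∈C with lem {c′ ≡ c}
    ... | yes refl = fixes
    ... | no c′≢c = fixesC∖c c′ (∈-∖⁺ c′∈C c′≢c)

  leastSupport⇒fungible : ∀ {C} {H : Sym D → Set} → IsLeastSupport DS C H →
    Fungible DS C
  leastSupport⇒fungible {C} (supC , least) c c∈C with lem {Mover C c}
  ... | yes mover = mover
  ... | no noMover =
    ⊥-elim (∈-∖⁻ {C} (least (C ∖ c) (supports-∖ supC noMover) c c∈C) refl)

  module _ (C : List D) {S : Sym (Fin (length C)) → Set} (S-subgroup : IsSubgroup S) where

    private
      module S = IsSubgroup S-subgroup

    ext-isSubgroupOfG : IsSubgroupOfG DS (ext DS C S)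
    ext-isSubgroupOfG = (λ _ → proj₁) , record
      { resp = λ π≗ρ → λ { (g , σ , s , πC≡Cσ) →
          G.resp π≗ρ g , σ , s , λ i → trans (sym (π≗ρ _)) (πC≡Cσ i) }
      ; id∈ = G.id∈ , ↔-id _ , S.id∈ , λ _ → refl
      ; ∘∈ = λ {π} → λ { (g₁ , σ₁ , s₁ , πC≡Cσ₁) (g₂ , σ₂ , s₂ , ρC≡Cσ₂) →
          G.∘∈ g₁ g₂ , σ₁ ↔-∘ σ₂ , S.∘∈ s₁ s₂ ,
          λ i → trans (cong (π ⟨$⟩_) (ρC≡Cσ₂ i)) (πC≡Cσ₁ _) }
      ; inv∈ = λ {π} → λ { (g , σ , s , πC≡Cσ) →
          G.inv∈ g , ↔-sym σ , S.inv∈ s , λ i →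
            trans (cong (Inverse.from π)
                    (trans (cong (lookup C) (sym (Inverse.strictlyInverseˡ σ i)))
                           (sym (πC≡Cσ _))))
                  (Inverse.strictlyInverseʳ π _) } }

    ExtMover : D → Set
    ExtMover c = Σ (Sym D) λ π → ext DS C S π × MovesOnly C c π

    ext-supports : Supports DS C (ext DS C S)
    ext-supports π (g , fixesC) = g , ↔-id _ , S.id∈ , λ i → fixesC _ (∈-lookup i)

    ext-notMovesOnly : ∀ {π c} → ext DS C S π → c ∈ C → ¬ MovesOnly C c π
    ext-notMovesOnly {π} (_ , σ , _ , πC≡Cσ) c∈C (moves , fixesRest) =
      moves (fixesAllBut⇒fixes π (subst (_∈ C) (sym πc≡) (∈-lookup _)) fixesRest)
      where
      πc≡ : π ⟨$⟩ _ ≡ lookup C (σ ⟨$⟩ index c∈C)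
      πc≡ = trans (cong (π ⟨$⟩_) (lookup-index c∈C)) (πC≡Cσ (index c∈C))

    ext-leastSupport :
      (∀ E → Supports DS E (ext DS C S) → ∀ c → c ∈ C → c ∉ E → ExtMover c) →
      IsLeastSupport DS C (ext DS C S)
    ext-leastSupport mover = ext-supports , least
      where
      least : ∀ E → Supports DS E (ext DS C S) → ∀ c → c ∈ C → c ∈ E
      least E supE c c∈C with lem {c ∈ E}
      ... | yes c∈E = c∈E
      ... | no c∉E with mover E supE c c∈C c∉E
      ... | π , π∈ext , movesOnly = ⊥-elim (ext-notMovesOnly π∈ext c∈C movesOnly)

    admitsLeastSupports⇒ext-leastSupport : AdmitsLeastSupports DS → Fungible DS C →
      IsLeastSupport DS C (ext DS C S)
    admitsLeastSupports⇒ext-leastSupport admits fungible = ext-leastSupport mover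
      where
      mover : ∀ E → Supports DS E (ext DS C S) → ∀ c → c ∈ C → c ∉ E → ExtMover c
      mover E supE c c∈C c∉E with fungible c c∈C
      ... | π , g , movesOnly@(_ , fixesRest) =
        π , admits _ ext-isSubgroupOfG C E ext-supports supE π (g , fixesC∩E) , movesOnly
        where
        fixesC∩E : ∀ c′ → (c′ ∈ C) × (c′ ∈ E) → π ⟨$⟩ c′ ≡ c′
        fixesC∩E c′ (c′∈C , c′∈E) = fixesRest c′ c′∈C λ { refl → c∉E c′∈E }

    fungible⇒ext-leastSupport : FungibleDS DS → IsLeastSupport DS C (ext DS C S)
    fungible⇒ext-leastSupport fungible = ext-leastSupport mover
      where
      mover : ∀ E → Supports DS E (ext DS C S) → ∀ c → c ∈ C → c ∉ E → ExtMover c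
      mover E supE c c∈C c∉E with fungible (E ++ C) c (∈-++⁺ʳ E c∈C)
      ... | π , g , moves , fixesRest =
        π , supE π (g , fixesE) , moves , λ c′ c′∈C → fixesRest c′ (∈-++⁺ʳ E c′∈C)
        where
        fixesE : ∀ c′ → c′ ∈ E → π ⟨$⟩ c′ ≡ c′
        fixesE c′ c′∈E = fixesRest c′ (∈-++⁺ˡ c′∈E) λ { refl → c∉E c′∈E }

lemma9p8 : ExcludedMiddle 0ℓ → (DS : DataSymmetry) →
    ((H : Sym (𝔻 DS) → Set) → IsSubgroupOfG DS H → IsOpen DS H →
    (C : List (𝔻 DS)) → IsLeastSupport DS C H → Fungible DS C)
    × (AdmitsLeastSupports DS → (C : List (𝔻 DS)) → Unique C → Fungible DS C →
    (S : Sym (Fin (length C)) → Set) → IsSubgroup S →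
    IsLeastSupport DS C (ext DS C S))
    × (FungibleDS DS → (C : List (𝔻 DS)) → Unique C →
    (S : Sym (Fin (length C)) → Set) → IsSubgroup S →
    IsLeastSupport DS C (ext DS C S))
lemma9p8 lem DS =
    (λ _ _ _ _ → leastSupport⇒fungible lem DS)
  , (λ admits C _ fungible _ S-subgroup →
       admitsLeastSupports⇒ext-leastSupport lem DS C S-subgroup admits fungible)
  , (λ fungible C _ _ S-subgroup →
       fungible⇒ext-leastSupport lem DS C S-subgroup fungible)
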